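{- Let $W=\langle W,\cdot,1_W\rangle$ be a monoid and let $T:\mathbf{Set}\to\mathbf{Set}$ be a set-forming operation. The following two kinds of structure on $T$ are equivalent. (I) A decorated traversable monad (DTM) structure on $T$, i.e. operations $(\mathrm{map}_T,\mathrm{ret},\mathrm{join},\mathrm{dec},\mathrm{dist})$ satisfying all DTM axioms listed in the context. (II) A Kleisli-presented DTM structure on $T$, i.e. operations $(\mathrm{ret},\mathrm{binddt})$ satisfying the Kleisli laws (K1)–(K4) listed in the context. Precisely: given a DTM structure, the operation $$\mathrm{binddt}_F\,f := \mathrm{map}_F(\mathrm{join})\circ \mathrm{dist}_F\circ \mathrm{map}_T f\circ \mathrm{dec}$$ (for an applicative $F$ and $f:W\times A\to F(TB)$), together with the same $\mathrm{ret}$, is a Kleisli-presented DTM; given a Kleisli-presented DTM, the operations (same $\mathrm{ret}$) $$\mathrm{map}_T f := \mathrm{binddt}_{\mathbb 1}(\mathrm{ret}\circ f\circ \mathrm{extr}),\quad \mathrm{dec} := \mathrm{binddt}_{\mathbb 1}(\mathrm{ret}),\quad \mathrm{join} := \mathrm{binddt}_{\mathbb 1}(\mathrm{extr}),\quad \mathrm{dist}_F := \mathrm{binddt}_F(\mathrm{ret}\circ\mathrm{extr})$$ form a DTM; and these two translations are mutually inverse.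
   Context: All functors are endofunctors of $\mathbf{Set}$; $\mathrm{map}_F$ denotes the action of a functor $F$ on functions. $\mathbb 1$ is the identity functor. Applicative functors: an applicative functor is $F:\mathbf{Set}\to\mathbf{Set}$ with $\mathrm{pure}:A\to FA$ and $\circledast: F(A\to B)\to FA\to FB$ (left associative) satisfying $\mathrm{pure}\,\mathrm{id}\circledast a=a$; $\mathrm{pure}\,f\circledast\mathrm{pure}\,a=\mathrm{pure}(f a)$; $g\circledast(f\circledast a)=\mathrm{pure}(\circ)\circledast g\circledast f\circledast a$; $f\circledast \mathrm{pure}\,a=\mathrm{pure}(\lambda h.\,h\,a)\circledast f$. Its functor action is $\mathrm{map}_F f\,x=\mathrm{pure} f\circledast x$. The identity functor is applicative, and composites $F\circ G$ of applicatives are applicative. An applicative morphism $\phi:F\Rightarrow G$ is a natural transformation with $\phi(\mathrm{pure}\,a)=\mathrm{pure}\,a$ and $\phi(f\circledast x)=\phi f\circledast\phi x$. Writer/environment operations on $W\times-$: $\mathrm{extr}(w,a)=a$; $\mathrm{dup}(w,a)=(w,(w,a))$; $\mathrm{ret}_{W\times}(a)=(1_W,a)$; $\mathrm{join}_{W\times}(w_1,(w_2,a))=(w_1\cdot w_2,a)$. For a functor $G$, the strength $\sigma_G:W\times GA\to G(W\times A)$ is $\sigma_G(w,x)=\mathrm{map}_G(\lambda a.(w,a))\,x$. DTM: a functor $T$ with natural transformations $\mathrm{ret}:A\to TA$, $\mathrm{join}:T(TA)\to TA$, $\mathrm{dec}:TA\to T(W\times A)$, and, for every applicative $F$, $\mathrm{dist}_F:T(FA)\to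 F(TA)$ natural in $A$, satisfying: (monad) $\mathrm{join}\circ\mathrm{ret}=\mathrm{id}$, $\mathrm{join}\circ\mathrm{map}_T\mathrm{ret}=\mathrm{id}$, $\mathrm{join}\circ\mathrm{join}=\mathrm{join}\circ\mathrm{map}_T\mathrm{join}$; (decorated functor) $\mathrm{map}_T\mathrm{extr}\circ\mathrm{dec}=\mathrm{id}$, $\mathrm{map}_T\mathrm{dup}\circ\mathrm{dec}=\mathrm{dec}\circ\mathrm{dec}$; (decorated monad) $\mathrm{dec}\circ\mathrm{ret}=\mathrm{ret}\circ\mathrm{ret}_{W\times}$, and $\mathrm{dec}\circ\mathrm{join}=\mathrm{join}\circ\mathrm{map}_T(\mathrm{map}_T(\mathrm{join}_{W\times})\circ\sigma_T)\circ\mathrm{dec}\circ\mathrm{map}_T\mathrm{dec}$; (traversable functor) $\mathrm{dist}_{\mathbb 1}=\mathrm{id}$, $\mathrm{dist}_{F\circ G}=\mathrm{map}_F(\mathrm{dist}_G)\circ\mathrm{dist}_F$, and $\phi\circ\mathrm{dist}_F=\mathrm{dist}_G\circ\mathrm{map}_T\phi$ for every applicative morphism $\phi:F\Rightarrow G$; (traversable monad) $\mathrm{dist}_F\circ\mathrm{ret}=\mathrm{map}_F\mathrm{ret}$, $\mathrm{dist}_F\circ\mathrm{join}=\mathrm{map}_F\mathrm{join}\circ\mathrm{dist}_F\circ\mathrm{map}_T\mathrm{dist}_F$; (decoration–traversal) $\mathrm{map}_F\mathrm{dec}\circ\mathrm{dist}_F=\mathrm{dist}_F\circ\mathrm{map}_T(\sigma_F)\circ\mathrm{dec}$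 as maps $T(FA)\to F(T(W\times A))$. (These are exactly the conditions for $T$ to be a monoid in the strict monoidal category of decorated-traversable functors.) Kleisli-presented DTM: operations $\mathrm{ret}:A\to TA$ and, for each applicative $F$ and sets $A,B$, $\mathrm{binddt}_F:(W\times A\to F(TB))\to TA\to F(TB)$, satisfying, with $(g\odot w_1)(w_2,b):=g(w_1\cdot w_2,b)$: (K1) $\mathrm{binddt}_{\mathbb 1}(\mathrm{ret}\circ\mathrm{extr})=\mathrm{id}_{TA}$; (K2) $\mathrm{binddt}_F f\circ\mathrm{ret}=f\circ\mathrm{ret}_{W\times}$; (K3) $\mathrm{map}_F(\mathrm{binddt}_G g)\circ\mathrm{binddt}_F f=\mathrm{binddt}_{F\circ G}\big(\lambda(w,a).\,\mathrm{map}_F(\mathrm{binddt}_G(g\odot w))(f(w,a))\big)$; (K4) $\phi\circ\mathrm{binddt}_F f=\mathrm{binddt}_G(\phi\circ f)$ for every applicative morphism $\phi:F\Rightarrow G$. -}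

module Defs where

open import Level using (0ℓ)
open import Function using (id; _∘_; _∘′_)
open import Data.Product using (_×_; _,_; proj₁; proj₂; map₂)
open import Relation.Binary.PropositionalEquality
open import Axiom.Extensionality.Propositional using (Extensionality)

record Applicative : Set₁ where
  infixl 5 _⊛_
  field
    F    : Set → Set
    pure : ∀ {A} → A → F A
    _⊛_  : ∀ {A B} → F (A → B) → F A → F B
    identity     : ∀ {A} (a : F A) → pure id ⊛ a ≡ a
    homomorphism : ∀ {A B} (f : A → B) (a : A) → pure f ⊛ pure a ≡ pure (f a)
    composition  : ∀ {A B C} (g : F (B → C)) (f : F (A → B)) (a : F A) →
                   g ⊛ (f ⊛ a) ≡ pure _∘′_ ⊛ g ⊛ f ⊛ a
    interchange  : ∀ {A B} (f : F (A → B)) (a : A) →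
                   f ⊛ pure a ≡ pure (λ h → h a) ⊛ f

  map : ∀ {A B} → (A → B) → F A → F B
  map f x = pure f ⊛ x

open Applicative public using () renaming (F to ⟦_⟧)

mapA : (Fa : Applicative) → ∀ {A B} → (A → B) → ⟦ Fa ⟧ A → ⟦ Fa ⟧ B
mapA Fa = Applicative.map Fa

IdA : Applicative
IdA = record
  { F = λ A → A
  ; pure = λ a → a
  ; _⊛_ = λ f a → f a
  ; identity = λ _ → refl
  ; homomorphism = λ _ _ → refl
  ; composition = λ _ _ _ → refl
  ; interchange = λ _ _ → refl
  }

record Morph (Fa Ga : Applicative) : Set₁ where
  field
    φ        : ∀ {A} → ⟦ Fa ⟧ A → ⟦ Ga ⟧ A
    natural  : ∀ {A B} (f : A → B) (x : ⟦ Fa ⟧ A) → φ (mapA Fa f x) ≡ mapA Ga f (φ x)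
    pres-pure : ∀ {A} (a : A) → φ (Applicative.pure Fa a) ≡ Applicative.pure Ga a
    pres-ap  : ∀ {A B} (f : ⟦ Fa ⟧ (A → B)) (x : ⟦ Fa ⟧ A) →
               φ (Applicative._⊛_ Fa f x) ≡ Applicative._⊛_ Ga (φ f) (φ x)

module Compose (ext : Extensionality 0ℓ 0ℓ) (Fa Ga : Applicative) where
  open Applicative Fa using (pure; _⊛_)
  open Applicative Ga using () renaming (pure to pureG; _⊛_ to _⊛G_)
  module AF = Applicative Fa
  module AG = Applicative Ga

  pureC : ∀ {A} → A → ⟦ Fa ⟧ (⟦ Ga ⟧ A)
  pureC a = pure (pureG a)

  apC : ∀ {A B} → ⟦ Fa ⟧ (⟦ Ga ⟧ (A → B)) → ⟦ Fa ⟧ (⟦ Ga ⟧ A) → ⟦ Fa ⟧ (⟦ Ga ⟧ B)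
  apC f x = pure _⊛G_ ⊛ f ⊛ x

  map-map : ∀ {A B C} (g : B → C) (f : A → B) (x : ⟦ Fa ⟧ A) →
            pure g ⊛ (pure f ⊛ x) ≡ pure (g ∘′ f) ⊛ x
  map-map g f x = trans (AF.composition (pure g) (pure f) x)
    (cong (λ z → z ⊛ x)
      (trans (cong (λ z → z ⊛ pure f) (AF.homomorphism _∘′_ g))
             (AF.homomorphism (g ∘′_) f)))

  map-ap : ∀ {A B C} (h : B → C) (u : ⟦ Fa ⟧ (A → B)) (x : ⟦ Fa ⟧ A) →
           pure h ⊛ (u ⊛ x) ≡ pure (h ∘′_) ⊛ u ⊛ x
  map-ap h u x = trans (AF.composition (pure h) u x)
    (cong (λ z → z ⊛ u ⊛ x) (AF.homomorphism _∘′_ h))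

  c-identity : ∀ {A} (a : ⟦ Fa ⟧ (⟦ Ga ⟧ A)) → apC (pureC id) a ≡ a
  c-identity a =
    trans (cong (λ z → z ⊛ a) (AF.homomorphism _⊛G_ (pureG id)))
   (trans (cong (λ z → pure z ⊛ a) (ext AG.identity))
          (AF.identity a))

  c-homomorphism : ∀ {A B} (f : A → B) (a : A) → apC (pureC f) (pureC a) ≡ pureC (f a)
  c-homomorphism f a =
    trans (cong (λ z → z ⊛ pure (pureG a)) (AF.homomorphism _⊛G_ (pureG f)))
   (trans (AF.homomorphism (pureG f ⊛G_) (pureG a))
          (cong pure (AG.homomorphism f a)))

  c-interchange : ∀ {A B} (f : ⟦ Fa ⟧ (⟦ Ga ⟧ (A → B))) (a : A) →
                  apC f (pureC a) ≡ apC (pureC (λ h → h a)) f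
  c-interchange f a =
    trans (AF.interchange (pure _⊛G_ ⊛ f) (pureG a))
   (trans (map-map (λ h → h (pureG a)) _⊛G_ f)
   (trans (cong (λ z → pure z ⊛ f) (ext (λ g → AG.interchange g a)))
          (sym (cong (λ z → z ⊛ f) (AF.homomorphism _⊛G_ (pureG (λ h → h a)))))))

  c-composition : ∀ {A B C} (g : ⟦ Fa ⟧ (⟦ Ga ⟧ (B → C))) (f : ⟦ Fa ⟧ (⟦ Ga ⟧ (A → B)))
                  (a : ⟦ Fa ⟧ (⟦ Ga ⟧ A)) →
                  apC g (apC f a) ≡ apC (apC (apC (pureC _∘′_) g) f) a
  c-composition {A} {B} {C} g f a = trans lhs (sym rhs)
    where
      k1 : ⟦ Ga ⟧ (B → C) → ⟦ Ga ⟧ (A → B) → ⟦ Ga ⟧ A → ⟦ Ga ⟧ C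
      k1 g' f' a' = g' ⊛G (f' ⊛G a')
      k2 : ⟦ Ga ⟧ (B → C) → ⟦ Ga ⟧ (A → B) → ⟦ Ga ⟧ A → ⟦ Ga ⟧ C
      k2 g' f' a' = pureG _∘′_ ⊛G g' ⊛G f' ⊛G a'
      k12 : k1 ≡ k2
      k12 = ext λ g' → ext λ f' → ext λ a' → AG.composition g' f' a'
      X = pure _⊛G_ ⊛ g
      lhs : apC g (apC f a) ≡ pure k2 ⊛ g ⊛ f ⊛ a
      lhs =
        trans (AF.composition X (pure _⊛G_ ⊛ f) a)
       (cong (_⊛ a)
       (trans (AF.composition (pure _∘′_ ⊛ X) (pure _⊛G_) f)
       (cong (_⊛ f)
       (trans (AF.interchange (pure _∘′_ ⊛ (pure _∘′_ ⊛ X)) _⊛G_)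
       (trans (map-map (λ h → h _⊛G_) _∘′_ (pure _∘′_ ⊛ X))
       (trans (map-map _ _∘′_ X)
       (trans (map-map _ _⊛G_ g)
              (cong (λ k → pure k ⊛ g) k12))))))))
      rhs : apC (apC (apC (pureC _∘′_) g) f) a ≡ pure k2 ⊛ g ⊛ f ⊛ a
      rhs =
        cong (_⊛ a)
       (trans (cong (λ z → pure _⊛G_ ⊛ (pure _⊛G_ ⊛ z ⊛ f))
                    (trans (cong (_⊛ g) (AF.homomorphism _⊛G_ (pureG _∘′_))) refl))
       (trans (map-ap _⊛G_ (pure _⊛G_ ⊛ (pure (pureG _∘′_ ⊛G_) ⊛ g)) f)
       (cong (_⊛ f)
       (trans (map-ap (_⊛G_ ∘′_) (pure _⊛G_) (pure (pureG _∘′_ ⊛G_) ⊛ g))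
       (trans (cong (_⊛ (pure (pureG _∘′_ ⊛G_) ⊛ g)) (AF.homomorphism _ _⊛G_))
       (map-map _ _ g))))))

  composite : Applicative
  composite = record
    { F = λ A → ⟦ Fa ⟧ (⟦ Ga ⟧ A)
    ; pure = pureC
    ; _⊛_ = apC
    ; identity = c-identity
    ; homomorphism = c-homomorphism
    ; composition = c-composition
    ; interchange = c-interchange
    }

module Theory (ext : Extensionality 0ℓ 0ℓ) (W : Set) (_·_ : W → W → W) (1W : W) where

  infixr 9 _∘A_
  _∘A_ : Applicative → Applicative → Applicative
  Fa ∘A Ga = Compose.composite ext Fa Ga

  extr : ∀ {A : Set} → W × A → A
  extr = proj₂

  dup : ∀ {A : Set} → W × A → W × (W × A)
  dup (w , a) = w , (w , a)

  retW : ∀ {A : Set} → A → W × A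
  retW a = 1W , a

  joinW : ∀ {A : Set} → W × (W × A) → W × A
  joinW (w₁ , (w₂ , a)) = w₁ · w₂ , a

  σ : (Fa : Applicative) → ∀ {A} → W × ⟦ Fa ⟧ A → ⟦ Fa ⟧ (W × A)
  σ Fa (w , x) = mapA Fa (λ a → w , a) x

  _⊙_ : ∀ {B C : Set} → (W × B → C) → W → W × B → C
  (g ⊙ w₁) (w₂ , b) = g (w₁ · w₂ , b)

  record DTMOps (T : Set → Set) : Set₁ where
    field
      mapT : ∀ {A B} → (A → B) → T A → T B
      ret  : ∀ {A} → A → T A
      join : ∀ {A} → T (T A) → T A
      dec  : ∀ {A} → T A → T (W × A)
      dist : (Fa : Applicative) → ∀ {A} → T (⟦ Fa ⟧ A) → ⟦ Fa ⟧ (T A)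

    σT : ∀ {A} → W × T A → T (W × A)
    σT (w , x) = mapT (λ a → w , a) x

  record IsDTM {T : Set → Set} (D : DTMOps T) : Set₁ where
    open DTMOps D
    field
      map-id   : ∀ {A} (x : T A) → mapT id x ≡ x
      map-∘    : ∀ {A B C} (g : B → C) (f : A → B) (x : T A) →
                 mapT (g ∘ f) x ≡ mapT g (mapT f x)
      ret-nat  : ∀ {A B} (f : A → B) (a : A) → mapT f (ret a) ≡ ret (f a)
      join-nat : ∀ {A B} (f : A → B) (x : T (T A)) →
                 mapT f (join x) ≡ join (mapT (mapT f) x)
      dec-nat  : ∀ {A B} (f : A → B) (x : T A) →
                 mapT (map₂ f) (dec x) ≡ dec (mapT f x)
      dist-nat : ∀ (Fa : Applicative) {A B} (f : A → B) (x : T (⟦ Fa ⟧ A)) →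
                 mapA Fa (mapT f) (dist Fa x) ≡ dist Fa (mapT (mapA Fa f) x)
      join-ret     : ∀ {A} (x : T A) → join (ret x) ≡ x
      join-map-ret : ∀ {A} (x : T A) → join (mapT ret x) ≡ x
      join-join    : ∀ {A} (x : T (T (T A))) → join (join x) ≡ join (mapT join x)
      dec-extr : ∀ {A} (x : T A) → mapT extr (dec x) ≡ x
      dec-dup  : ∀ {A} (x : T A) → mapT dup (dec x) ≡ dec (dec x)
      dec-ret  : ∀ {A} (a : A) → dec (ret a) ≡ ret (retW a)
      dec-join : ∀ {A} (x : T (T A)) →
                 dec (join x) ≡ join (mapT (mapT joinW ∘ σT) (dec (mapT dec x)))
      dist-id    : ∀ {A} (x : T A) → dist IdA x ≡ x
      dist-comp  : ∀ (Fa Ga : Applicative) {A} (x : T (⟦ Fa ⟧ (⟦ Ga ⟧ A))) →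
                   dist (Fa ∘A Ga) x ≡ mapA Fa (dist Ga) (dist Fa x)
      dist-morph : ∀ {Fa Ga : Applicative} (ψ : Morph Fa Ga) {A} (x : T (⟦ Fa ⟧ A)) →
                   Morph.φ ψ (dist Fa x) ≡ dist Ga (mapT (Morph.φ ψ) x)
      dist-ret  : ∀ (Fa : Applicative) {A} (a : ⟦ Fa ⟧ A) →
                  dist Fa (ret a) ≡ mapA Fa ret a
      dist-join : ∀ (Fa : Applicative) {A} (x : T (T (⟦ Fa ⟧ A))) →
                  dist Fa (join x) ≡ mapA Fa join (dist Fa (mapT (dist Fa) x))
      dec-dist  : ∀ (Fa : Applicative) {A} (x : T (⟦ Fa ⟧ A)) →
                  mapA Fa dec (dist Fa x) ≡ dist Fa (mapT (σ Fa) (dec x))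

  record KOps (T : Set → Set) : Set₁ where
    field
      ret    : ∀ {A} → A → T A
      binddt : (Fa : Applicative) → ∀ {A B} →
               (W × A → ⟦ Fa ⟧ (T B)) → T A → ⟦ Fa ⟧ (T B)

  record IsKDTM {T : Set → Set} (K : KOps T) : Set₁ where
    open KOps K
    field
      K1 : ∀ {A} (x : T A) → binddt IdA (ret ∘ extr) x ≡ x
      K2 : ∀ (Fa : Applicative) {A B} (f : W × A → ⟦ Fa ⟧ (T B)) (a : A) →
           binddt Fa f (ret a) ≡ f (retW a)
      K3 : ∀ (Fa Ga : Applicative) {A B C}
             (f : W × A → ⟦ Fa ⟧ (T B)) (g : W × B → ⟦ Ga ⟧ (T C)) (x : T A) →
           mapA Fa (binddt Ga g) (binddt Fa f x)
             ≡ binddt (Fa ∘A Ga) (λ wa → mapA Fa (binddt Ga (g ⊙ proj₁ wa)) (f wa)) x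
      K4 : ∀ {Fa Ga : Applicative} (ψ : Morph Fa Ga) {A B}
             (f : W × A → ⟦ Fa ⟧ (T B)) (x : T A) →
           Morph.φ ψ (binddt Fa f x) ≡ binddt Ga (Morph.φ ψ ∘ f) x

  toK : ∀ {T} → DTMOps T → KOps T
  toK D = record
    { ret = DTMOps.ret D
    ; binddt = λ Fa f x →
        mapA Fa (DTMOps.join D) (DTMOps.dist D Fa (DTMOps.mapT D f (DTMOps.dec D x)))
    }

  toD : ∀ {T} → KOps T → DTMOps T
  toD K = record
    { mapT = λ f → KOps.binddt K IdA (KOps.ret K ∘ f ∘ extr)
    ; ret  = KOps.ret K
    ; join = KOps.binddt K IdA extr
    ; dec  = KOps.binddt K IdA (KOps.ret K)
    ; dist = λ Fa → KOps.binddt K Fa (mapA Fa (KOps.ret K) ∘ extr)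
    }

  record _≈D_ {T : Set → Set} (D D′ : DTMOps T) : Set₁ where
    module D = DTMOps D
    module D′ = DTMOps D′
    field
      mapT-eq : ∀ {A B} (f : A → B) (x : T A) → D.mapT f x ≡ D′.mapT f x
      ret-eq  : ∀ {A} (a : A) → D.ret a ≡ D′.ret a
      join-eq : ∀ {A} (x : T (T A)) → D.join x ≡ D′.join x
      dec-eq  : ∀ {A} (x : T A) → D.dec x ≡ D′.dec x
      dist-eq : ∀ (Fa : Applicative) {A} (x : T (⟦ Fa ⟧ A)) → D.dist Fa x ≡ D′.dist Fa x

  record _≈K_ {T : Set → Set} (K K′ : KOps T) : Set₁ where
    module K = KOps K
    module K′ = KOps K′
    field
      ret-eq    : ∀ {A} (a : A) → K.ret a ≡ K′.ret a
      binddt-eq : ∀ (Fa : Applicative) {A B} (f : W × A → ⟦ Fa ⟧ (T B)) (x : T A) →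
                  K.binddt Fa f x ≡ K′.binddt Fa f x

-- The Kleisli operation binddt F f = map_F join ∘ dist_F ∘ map_T f ∘ dec packages
-- all DTM operations, and its composition law (K3) carries all their interaction laws.
-- Given (K1)–(K4), each DTM axiom is proved by fusing both sides into a single binddt
-- (by (K3) with one applicative the identity, made strict by the unit morphisms
-- 𝟙 ∘ G ⇒ G and F ∘ 𝟙 ⇒ F) and then cancelling binddt f ∘ ret by (K2).
-- Conversely, for a DTM, (K3) reduces to the fusion
-- binddt_G g ∘ join = binddt_G (λ (w , t) → binddt_G (g ⊙ w) t), after which dec–dist,
-- dec–dup and dist-composition move dec and dist_G past dist_F.
module Submission where

open import Level using (0ℓ)
open import Function using (id; _∘_; _∘′_)
open import Data.Product using (_×_; _,_; proj₁; proj₂; map₂)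
open import Relation.Binary.PropositionalEquality
open import Algebra.Structures using (IsMonoid)
open import Axiom.Extensionality.Propositional using (Extensionality)

open import Defs

module Equivalence (ext : Extensionality 0ℓ 0ℓ) (W : Set) (_·_ : W → W → W) (1W : W) where
  open Theory ext W _·_ 1W

  mapA-id : ∀ Fa {A} (x : ⟦ Fa ⟧ A) → mapA Fa id x ≡ x
  mapA-id Fa = Applicative.identity Fa

  mapA-∘ : ∀ Fa {A B C} (g : B → C) (f : A → B) (x : ⟦ Fa ⟧ A) →
           mapA Fa (g ∘ f) x ≡ mapA Fa g (mapA Fa f x)
  mapA-∘ Fa g f x = sym (begin
      pure g ⊛ (pure f ⊛ x)
        ≡⟨ composition (pure g) (pure f) x ⟩
      pure _∘′_ ⊛ pure g ⊛ pure f ⊛ x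
        ≡⟨ cong (λ h → h ⊛ pure f ⊛ x) (homomorphism _∘′_ g) ⟩
      pure (g ∘′_) ⊛ pure f ⊛ x
        ≡⟨ cong (_⊛ x) (homomorphism (g ∘′_) f) ⟩
      pure (g ∘ f) ⊛ x
        ∎)
    where open Applicative Fa
          open ≡-Reasoning

  mapA-cong : ∀ Fa {A B} {f g : A → B} → (∀ a → f a ≡ g a) →
              ∀ x → mapA Fa f x ≡ mapA Fa g x
  mapA-cong Fa f≗g x = cong (λ h → mapA Fa h x) (ext f≗g)

  mapA-retract : ∀ Fa {A B} {f : A → B} {g : B → A} → (∀ a → g (f a) ≡ a) →
                 ∀ x → mapA Fa g (mapA Fa f x) ≡ x
  mapA-retract Fa {f = f} {g} g∘f≗id x = begin
    mapA Fa g (mapA Fa f x) ≡⟨ mapA-∘ Fa g f x ⟨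
    mapA Fa (g ∘ f) x       ≡⟨ mapA-cong Fa g∘f≗id x ⟩
    mapA Fa id x            ≡⟨ mapA-id Fa x ⟩
    x                       ∎
    where open ≡-Reasoning

  mapA-composite : ∀ Fa Ga {A B} (f : A → B) (x : ⟦ Fa ∘A Ga ⟧ A) →
                   mapA (Fa ∘A Ga) f x ≡ mapA Fa (mapA Ga f) x
  mapA-composite Fa Ga f x =
    cong (λ h → Applicative._⊛_ Fa h x)
         (Applicative.homomorphism Fa (Applicative._⊛_ Ga) (Applicative.pure Ga f))

  unitˡ : ∀ Ga → Morph (IdA ∘A Ga) Ga
  unitˡ Ga = record
    { φ         = id
    ; natural   = λ _ _ → refl
    ; pres-pure = λ _ → refl
    ; pres-ap   = λ _ _ → refl
    }

  unitʳ : ∀ Fa → Morph (Fa ∘A IdA) Fa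
  unitʳ Fa = record
    { φ         = id
    ; natural   = λ f x → cong (_⊛ x) (identity (pure f))
    ; pres-pure = λ _ → refl
    ; pres-ap   = λ f x → cong (_⊛ x) (identity f)
    }
    where open Applicative Fa

  module KleisliToDTM (·-identityʳ : ∀ w → w · 1W ≡ w)
                      {T : Set → Set} (K : KOps T) (isK : IsKDTM K) where
    open KOps K
    open IsKDTM isK
    open DTMOps (toD K) using (mapT; join; dec; dist; σT)
    open ≡-Reasoning

    -- Many steps in both directions hold by computation: g ⊙ w reduces to g when g
    -- ignores the decoration (e.g. g = f ∘ extr), and g ∘ joinW ∘ (w ,_) reduces to g ⊙ w.

    bindd : ∀ {A B} → (W × A → T B) → T A → T B
    bindd = binddt IdA

    binddt-cong : ∀ Fa {A B} {f g : W × A → ⟦ Fa ⟧ (T B)} → (∀ p → f p ≡ g p) →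
                  ∀ x → binddt Fa f x ≡ binddt Fa g x
    binddt-cong Fa f≗g x = cong (λ h → binddt Fa h x) (ext f≗g)

    binddt-bindd : ∀ Ga {A B C} (f : W × A → T B) (g : W × B → ⟦ Ga ⟧ (T C)) (x : T A) →
                   binddt Ga g (bindd f x)
                     ≡ binddt Ga (λ (w , a) → binddt Ga (g ⊙ w) (f (w , a))) x
    binddt-bindd Ga f g x = trans (K3 IdA Ga f g x) (K4 (unitˡ Ga) _ x)

    mapA-bindd-binddt : ∀ Fa {A B C} (f : W × A → ⟦ Fa ⟧ (T B)) (g : W × B → T C) (x : T A) →
                        mapA Fa (bindd g) (binddt Fa f x)
                          ≡ binddt Fa (λ (w , a) → mapA Fa (bindd (g ⊙ w)) (f (w , a))) x
    mapA-bindd-binddt Fa f g x = trans (K3 Fa IdA f g x) (K4 (unitʳ Fa) _ x)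

    binddt-bindd-ret : ∀ Ga {A B C} (h : W × A → B) (g : W × B → ⟦ Ga ⟧ (T C)) (x : T A) →
                       binddt Ga g (bindd (ret ∘ h) x) ≡ binddt Ga (λ (w , a) → g (w , h (w , a))) x
    binddt-bindd-ret Ga h g x =
      trans (binddt-bindd Ga (ret ∘ h) g x) (binddt-cong Ga collapse x)
      where
      collapse : ∀ p → binddt Ga (g ⊙ proj₁ p) (ret (h p)) ≡ g (proj₁ p , h p)
      collapse (w , a) = trans (K2 Ga (g ⊙ w) (h (w , a)))
                               (cong (λ v → g (v , h (w , a))) (·-identityʳ w))

    binddt-mapT : ∀ Ga {A B C} (g : W × B → ⟦ Ga ⟧ (T C)) (f : A → B) (x : T A) →
                  binddt Ga g (mapT f x) ≡ binddt Ga (g ∘ map₂ f) x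
    binddt-mapT Ga g f = binddt-bindd-ret Ga (f ∘ extr) g

    binddt-dec : ∀ Ga {A C} (g : W × (W × A) → ⟦ Ga ⟧ (T C)) (x : T A) →
                 binddt Ga g (dec x) ≡ binddt Ga (g ∘ dup) x
    binddt-dec Ga g = binddt-bindd-ret Ga id g

    mapA-mapT-binddt : ∀ Fa {A B C} (f : B → C) (g : W × A → ⟦ Fa ⟧ (T B)) (x : T A) →
                       mapA Fa (mapT f) (binddt Fa g x) ≡ binddt Fa (mapA Fa (mapT f) ∘ g) x
    mapA-mapT-binddt Fa f g = mapA-bindd-binddt Fa g (ret ∘ f ∘ extr)

    mapT-dec : ∀ {A B} (f : W × A → B) (x : T A) → mapT f (dec x) ≡ bindd (ret ∘ f) x
    mapT-dec f x = trans (mapA-mapT-binddt IdA f ret x) (binddt-cong IdA (K2 IdA _) x)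

    mapT-∘ : ∀ {A B C} (g : B → C) (f : A → B) (x : T A) → mapT (g ∘ f) x ≡ mapT g (mapT f x)
    mapT-∘ g f x = sym (binddt-mapT IdA (ret ∘ g ∘ extr) f x)

    join-ret : ∀ {A} (t : T A) → join (ret t) ≡ t
    join-ret = K2 IdA extr

    dist-nat : ∀ Fa {A B} (f : A → B) (x : T (⟦ Fa ⟧ A)) →
               mapA Fa (mapT f) (dist Fa x) ≡ dist Fa (mapT (mapA Fa f) x)
    dist-nat Fa f x = begin
      mapA Fa (mapT f) (dist Fa x)
        ≡⟨ mapA-mapT-binddt Fa f _ x ⟩
      binddt Fa (mapA Fa (mapT f) ∘ mapA Fa ret ∘ extr) x
        ≡⟨ binddt-cong Fa (λ (_ , a) → ret-commutes a) x ⟩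
      binddt Fa (mapA Fa ret ∘ mapA Fa f ∘ extr) x
        ≡⟨ binddt-mapT Fa _ (mapA Fa f) x ⟨
      dist Fa (mapT (mapA Fa f) x)
        ∎
      where
      ret-commutes : ∀ a → mapA Fa (mapT f) (mapA Fa ret a) ≡ mapA Fa ret (mapA Fa f a)
      ret-commutes a = begin
        mapA Fa (mapT f) (mapA Fa ret a) ≡⟨ mapA-∘ Fa (mapT f) ret a ⟨
        mapA Fa (mapT f ∘ ret) a         ≡⟨ mapA-cong Fa (K2 IdA _) a ⟩
        mapA Fa (ret ∘ f) a              ≡⟨ mapA-∘ Fa ret f a ⟩
        mapA Fa ret (mapA Fa f a)        ∎

    dec-join : ∀ {A} (x : T (T A)) →
               dec (join x) ≡ join (mapT (mapT joinW ∘ σT) (dec (mapT dec x)))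
    dec-join x = begin
      dec (join x)
        ≡⟨ binddt-bindd IdA extr ret x ⟩
      bindd (λ (w , t) → bindd (ret ⊙ w) t) x
        ≡⟨ binddt-cong IdA shift x ⟨
      bindd (λ (w , t) → mapT joinW (σT (w , dec t))) x
        ≡⟨ binddt-mapT IdA _ dec x ⟨
      bindd (extr ∘ map₂ (mapT joinW ∘ σT) ∘ dup) (mapT dec x)
        ≡⟨ binddt-dec IdA _ (mapT dec x) ⟨
      bindd (extr ∘ map₂ (mapT joinW ∘ σT)) (dec (mapT dec x))
        ≡⟨ binddt-mapT IdA extr _ _ ⟨
      join (mapT (mapT joinW ∘ σT) (dec (mapT dec x)))
        ∎
      where
      shift : ∀ p → mapT joinW (σT (proj₁ p , dec (proj₂ p)))
                      ≡ bindd (ret ⊙ proj₁ p) (proj₂ p)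
      shift (w , t) = trans (sym (mapT-∘ joinW (w ,_) (dec t))) (mapT-dec _ t)

    dist-comp : ∀ Fa Ga {A} (x : T (⟦ Fa ⟧ (⟦ Ga ⟧ A))) →
                dist (Fa ∘A Ga) x ≡ mapA Fa (dist Ga) (dist Fa x)
    dist-comp Fa Ga x =
      trans (binddt-cong (Fa ∘A Ga) (λ (_ , a) → inner a) x) (sym (K3 Fa Ga _ _ x))
      where
      inner : ∀ a → mapA (Fa ∘A Ga) ret a ≡ mapA Fa (dist Ga) (mapA Fa ret a)
      inner a = begin
        mapA (Fa ∘A Ga) ret a             ≡⟨ mapA-composite Fa Ga ret a ⟩
        mapA Fa (mapA Ga ret) a           ≡⟨ mapA-cong Fa (λ t → K2 Ga _ t) a ⟨
        mapA Fa (dist Ga ∘ ret) a         ≡⟨ mapA-∘ Fa (dist Ga) ret a ⟩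
        mapA Fa (dist Ga) (mapA Fa ret a) ∎

    dist-morph : ∀ {Fa Ga} (ψ : Morph Fa Ga) {A} (x : T (⟦ Fa ⟧ A)) →
                 Morph.φ ψ (dist Fa x) ≡ dist Ga (mapT (Morph.φ ψ) x)
    dist-morph ψ x =
      trans (K4 ψ _ x)
     (trans (binddt-cong _ (λ (_ , a) → Morph.natural ψ ret a) x)
            (sym (binddt-mapT _ _ (Morph.φ ψ) x)))

    dist-join : ∀ Fa {A} (x : T (T (⟦ Fa ⟧ A))) →
                dist Fa (join x) ≡ mapA Fa join (dist Fa (mapT (dist Fa) x))
    dist-join Fa x = begin
      dist Fa (join x)
        ≡⟨ binddt-bindd Fa extr _ x ⟩
      binddt Fa (dist Fa ∘ extr) x
        ≡⟨ binddt-cong Fa (λ (_ , t) → mapA-retract Fa join-ret (dist Fa t)) x ⟨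
      binddt Fa (mapA Fa join ∘ mapA Fa ret ∘ dist Fa ∘ extr) x
        ≡⟨ mapA-bindd-binddt Fa _ extr x ⟨
      mapA Fa join (binddt Fa (mapA Fa ret ∘ dist Fa ∘ extr) x)
        ≡⟨ cong (mapA Fa join) (binddt-mapT Fa _ (dist Fa) x) ⟨
      mapA Fa join (dist Fa (mapT (dist Fa) x))
        ∎

    dec-dist : ∀ Fa {A} (x : T (⟦ Fa ⟧ A)) →
               mapA Fa dec (dist Fa x) ≡ dist Fa (mapT (σ Fa) (dec x))
    dec-dist Fa x = begin
      mapA Fa dec (dist Fa x)
        ≡⟨ mapA-bindd-binddt Fa _ ret x ⟩
      binddt Fa (λ (w , a) → mapA Fa (bindd (ret ⊙ w)) (mapA Fa ret a)) x
        ≡⟨ binddt-cong Fa decorate x ⟩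
      binddt Fa (λ (w , a) → mapA Fa ret (mapA Fa (w ,_) a)) x
        ≡⟨ binddt-dec Fa _ x ⟨
      binddt Fa (mapA Fa ret ∘ extr ∘ map₂ (σ Fa)) (dec x)
        ≡⟨ binddt-mapT Fa _ (σ Fa) (dec x) ⟨
      dist Fa (mapT (σ Fa) (dec x))
        ∎
      where
      decorate : ∀ p → mapA Fa (bindd (ret ⊙ proj₁ p)) (mapA Fa ret (proj₂ p))
                         ≡ mapA Fa ret (mapA Fa (proj₁ p ,_) (proj₂ p))
      decorate (w , a) = begin
        mapA Fa (bindd (ret ⊙ w)) (mapA Fa ret a)
          ≡⟨ mapA-∘ Fa _ ret a ⟨
        mapA Fa (bindd (ret ⊙ w) ∘ ret) a
          ≡⟨ mapA-cong Fa (K2 IdA (ret ⊙ w)) a ⟩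
        mapA Fa (λ t → ret (w · 1W , t)) a
          ≡⟨ mapA-cong Fa (λ t → cong (ret ∘ (_, t)) (·-identityʳ w)) a ⟩
        mapA Fa (ret ∘ (w ,_)) a
          ≡⟨ mapA-∘ Fa ret (w ,_) a ⟩
        mapA Fa ret (mapA Fa (w ,_) a)
          ∎

    isDTM : IsDTM (toD K)
    isDTM = record
      { map-id       = K1
      ; map-∘        = mapT-∘
      ; ret-nat      = λ _ → K2 IdA _
      ; join-nat     = λ f x → trans (mapA-mapT-binddt IdA f extr x)
                                      (sym (binddt-mapT IdA extr (mapT f) x))
      ; dec-nat      = λ f x → trans (mapT-dec (map₂ f) x) (sym (binddt-mapT IdA ret f x))
      ; dist-nat     = dist-nat
      ; join-ret     = join-ret
      ; join-map-ret = λ x → trans (binddt-mapT IdA extr ret x) (K1 x)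
      ; join-join    = λ x → trans (binddt-bindd IdA extr extr x)
                                      (sym (binddt-mapT IdA extr join x))
      ; dec-extr     = λ x → trans (binddt-dec IdA _ x) (K1 x)
      ; dec-dup      = λ x → trans (mapT-dec dup x) (sym (binddt-dec IdA ret x))
      ; dec-ret      = K2 IdA ret
      ; dec-join     = dec-join
      ; dist-id      = K1
      ; dist-comp    = dist-comp
      ; dist-morph   = dist-morph
      ; dist-ret     = λ Fa → K2 Fa _
      ; dist-join    = dist-join
      ; dec-dist     = dec-dist
      }

    toK∘toD≈id : toK (toD K) ≈K K
    toK∘toD≈id = record { ret-eq = λ _ → refl ; binddt-eq = binddt-eq }
      where
      binddt-eq : ∀ Fa {A B} (f : W × A → ⟦ Fa ⟧ (T B)) (x : T A) →
                  mapA Fa join (dist Fa (mapT f (dec x))) ≡ binddt Fa f x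
      binddt-eq Fa f x = begin
        mapA Fa join (dist Fa (mapT f (dec x)))
          ≡⟨ cong (mapA Fa join ∘ dist Fa) (mapT-dec f x) ⟩
        mapA Fa join (dist Fa (bindd (ret ∘ f) x))
          ≡⟨ cong (mapA Fa join) (binddt-bindd-ret Fa f _ x) ⟩
        mapA Fa join (binddt Fa (mapA Fa ret ∘ f) x)
          ≡⟨ mapA-bindd-binddt Fa _ extr x ⟩
        binddt Fa (mapA Fa join ∘ mapA Fa ret ∘ f) x
          ≡⟨ binddt-cong Fa (mapA-retract Fa join-ret ∘ f) x ⟩
        binddt Fa f x
          ∎

  module DTMToKleisli {T : Set → Set} (D : DTMOps T) (isD : IsDTM D) where
    open DTMOps D
    open IsDTM isD
    open KOps (toK D) using (binddt)
    open ≡-Reasoning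

    mapT-cong : ∀ {A B} {f g : A → B} → (∀ a → f a ≡ g a) → ∀ x → mapT f x ≡ mapT g x
    mapT-cong f≗g x = cong (λ h → mapT h x) (ext f≗g)

    mapT-extr-dec : ∀ {A B} (f : A → B) (x : T A) → mapT (f ∘ extr) (dec x) ≡ mapT f x
    mapT-extr-dec f x = trans (map-∘ f extr (dec x)) (cong (mapT f) (dec-extr x))

    binddt-IdA-ret : ∀ {A B} (h : W × A → B) (x : T A) → binddt IdA (ret ∘ h) x ≡ mapT h (dec x)
    binddt-IdA-ret h x = begin
      join (dist IdA (mapT (ret ∘ h) (dec x))) ≡⟨ cong join (dist-id _) ⟩
      join (mapT (ret ∘ h) (dec x))            ≡⟨ cong join (map-∘ ret h (dec x)) ⟩
      join (mapT ret (mapT h (dec x)))         ≡⟨ join-map-ret _ ⟩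
      mapT h (dec x)                           ∎

    dec-mapT-dec : ∀ {A B} (f : W × A → B) (x : T A) →
                   dec (mapT f (dec x)) ≡ mapT (λ (w , a) → w , f (w , a)) (dec x)
    dec-mapT-dec f x = begin
      dec (mapT f (dec x))             ≡⟨ dec-nat f (dec x) ⟨
      mapT (map₂ f) (dec (dec x))      ≡⟨ cong (mapT (map₂ f)) (dec-dup x) ⟨
      mapT (map₂ f) (mapT dup (dec x)) ≡⟨ map-∘ (map₂ f) dup (dec x) ⟨
      mapT (map₂ f ∘ dup) (dec x)      ∎

    binddt-join : ∀ Ga {A B} (g : W × A → ⟦ Ga ⟧ (T B)) (y : T (T A)) →
                  binddt Ga g (join y) ≡ binddt Ga (λ (w , t) → binddt Ga (g ⊙ w) t) y
    binddt-join Ga {A} g y = begin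
      mapA Ga join (dist Ga (mapT g (dec (join y))))
        ≡⟨ cong (λ z → mapA Ga join (dist Ga (mapT g z))) (dec-join y) ⟩
      mapA Ga join (dist Ga (mapT g (join z)))
        ≡⟨ cong (mapA Ga join ∘ dist Ga) (join-nat g z) ⟩
      mapA Ga join (dist Ga (join (mapT (mapT g) z)))
        ≡⟨ cong (mapA Ga join) (dist-join Ga _) ⟩
      mapA Ga join (mapA Ga join (dist Ga (mapT (dist Ga) (mapT (mapT g) z))))
        ≡⟨ mapA-∘ Ga join join _ ⟨
      mapA Ga (join ∘ join) (dist Ga (mapT (dist Ga) (mapT (mapT g) z)))
        ≡⟨ mapA-cong Ga join-join _ ⟩
      mapA Ga (join ∘ mapT join) (dist Ga (mapT (dist Ga) (mapT (mapT g) z)))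
        ≡⟨ mapA-∘ Ga join (mapT join) _ ⟩
      mapA Ga join (mapA Ga (mapT join) (dist Ga (mapT (dist Ga) (mapT (mapT g) z))))
        ≡⟨ cong (mapA Ga join) (dist-nat Ga join _) ⟩
      mapA Ga join (dist Ga (mapT (mapA Ga join) (mapT (dist Ga) (mapT (mapT g) z))))
        ≡⟨ cong (mapA Ga join ∘ dist Ga) fuse ⟩
      mapA Ga join (dist Ga (mapT (λ (w , t) → binddt Ga (g ⊙ w) t) (dec y)))
        ∎
      where
      shift : W × T (W × A) → T (W × A)
      shift = mapT joinW ∘ σT
      z : T (T (W × A))
      z = mapT shift (dec (mapT dec y))

      shift-dec : ∀ p → mapT g (shift (map₂ dec p)) ≡ mapT (g ⊙ proj₁ p) (dec (proj₂ p))
      shift-dec (w , t) = begin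
        mapT g (mapT joinW (mapT (w ,_) (dec t))) ≡⟨ cong (mapT g) (map-∘ joinW (w ,_) (dec t)) ⟨
        mapT g (mapT (joinW ∘ (w ,_)) (dec t))    ≡⟨ map-∘ g (joinW ∘ (w ,_)) (dec t) ⟨
        mapT (g ⊙ w) (dec t)                      ∎

      fuse : mapT (mapA Ga join) (mapT (dist Ga) (mapT (mapT g) z))
               ≡ mapT (λ (w , t) → binddt Ga (g ⊙ w) t) (dec y)
      fuse = begin
        mapT (mapA Ga join) (mapT (dist Ga) (mapT (mapT g) z))
          ≡⟨ cong (mapT (mapA Ga join)) (map-∘ (dist Ga) (mapT g) z) ⟨
        mapT (mapA Ga join) (mapT (dist Ga ∘ mapT g) z)
          ≡⟨ map-∘ (mapA Ga join) (dist Ga ∘ mapT g) z ⟨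
        mapT (mapA Ga join ∘ dist Ga ∘ mapT g) (mapT shift (dec (mapT dec y)))
          ≡⟨ map-∘ _ shift _ ⟨
        mapT (mapA Ga join ∘ dist Ga ∘ mapT g ∘ shift) (dec (mapT dec y))
          ≡⟨ cong (mapT _) (dec-nat dec y) ⟨
        mapT (mapA Ga join ∘ dist Ga ∘ mapT g ∘ shift) (mapT (map₂ dec) (dec y))
          ≡⟨ map-∘ _ (map₂ dec) (dec y) ⟨
        mapT (mapA Ga join ∘ dist Ga ∘ mapT g ∘ shift ∘ map₂ dec) (dec y)
          ≡⟨ mapT-cong (cong (mapA Ga join ∘ dist Ga) ∘ shift-dec) (dec y) ⟩
        mapT (λ (w , t) → binddt Ga (g ⊙ w) t) (dec y)
          ∎

    binddt-binddt : ∀ Fa Ga {A B C} (f : W × A → ⟦ Fa ⟧ (T B)) (g : W × B → ⟦ Ga ⟧ (T C))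
                    (x : T A) →
                    mapA Fa (binddt Ga g) (binddt Fa f x)
                      ≡ binddt (Fa ∘A Ga) (λ (w , a) → mapA Fa (binddt Ga (g ⊙ w)) (f (w , a))) x
    binddt-binddt Fa Ga {A} {B} {C} f g x = begin
      mapA Fa (binddt Ga g) (mapA Fa join (dist Fa u))
        ≡⟨ mapA-∘ Fa _ join _ ⟨
      mapA Fa (binddt Ga g ∘ join) (dist Fa u)
        ≡⟨ mapA-cong Fa (binddt-join Ga g) _ ⟩
      mapA Fa (mapA Ga join ∘ dist Ga ∘ mapT k ∘ dec) (dist Fa u)
        ≡⟨ mapA-∘ Fa _ dec _ ⟩
      mapA Fa (mapA Ga join ∘ dist Ga ∘ mapT k) (mapA Fa dec (dist Fa u))
        ≡⟨ cong (mapA Fa (mapA Ga join ∘ dist Ga ∘ mapT k)) (dec-dist Fa u) ⟩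
      mapA Fa (mapA Ga join ∘ dist Ga ∘ mapT k) (dist Fa (mapT (σ Fa) (dec u)))
        ≡⟨ cong (mapA Fa (mapA Ga join ∘ dist Ga ∘ mapT k) ∘ dist Fa) decorate ⟩
      mapA Fa (mapA Ga join ∘ dist Ga ∘ mapT k) (dist Fa v)
        ≡⟨ mapA-∘ Fa (mapA Ga join) _ _ ⟩
      mapA Fa (mapA Ga join) (mapA Fa (dist Ga ∘ mapT k) (dist Fa v))
        ≡⟨ cong (mapA Fa (mapA Ga join)) (mapA-∘ Fa (dist Ga) (mapT k) _) ⟩
      mapA Fa (mapA Ga join) (mapA Fa (dist Ga) (mapA Fa (mapT k) (dist Fa v)))
        ≡⟨ cong (mapA Fa (mapA Ga join) ∘ mapA Fa (dist Ga)) (dist-nat Fa k v) ⟩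
      mapA Fa (mapA Ga join) (mapA Fa (dist Ga) (dist Fa (mapT (mapA Fa k) v)))
        ≡⟨ cong (mapA Fa (mapA Ga join)) (dist-comp Fa Ga _) ⟨
      mapA Fa (mapA Ga join) (dist (Fa ∘A Ga) (mapT (mapA Fa k) v))
        ≡⟨ cong (mapA Fa (mapA Ga join) ∘ dist (Fa ∘A Ga)) (map-∘ (mapA Fa k) σf (dec x)) ⟨
      mapA Fa (mapA Ga join) (dist (Fa ∘A Ga) (mapT (mapA Fa k ∘ σf) (dec x)))
        ≡⟨ cong (mapA Fa (mapA Ga join) ∘ dist (Fa ∘A Ga)) (mapT-cong strengthen (dec x)) ⟩
      mapA Fa (mapA Ga join) (dist (Fa ∘A Ga) (mapT h (dec x)))
        ≡⟨ mapA-composite Fa Ga join _ ⟨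
      binddt (Fa ∘A Ga) h x
        ∎
      where
      u : T (⟦ Fa ⟧ (T B))
      u = mapT f (dec x)
      k : W × T B → ⟦ Ga ⟧ (T C)
      k (w , t) = binddt Ga (g ⊙ w) t
      h : W × A → ⟦ Fa ∘A Ga ⟧ (T C)
      h (w , a) = mapA Fa (binddt Ga (g ⊙ w)) (f (w , a))
      σf : W × A → ⟦ Fa ⟧ (W × T B)
      σf (w , a) = σ Fa (w , f (w , a))
      v : T (⟦ Fa ⟧ (W × T B))
      v = mapT σf (dec x)

      decorate : mapT (σ Fa) (dec u) ≡ v
      decorate = trans (cong (mapT (σ Fa)) (dec-mapT-dec f x)) (sym (map-∘ (σ Fa) _ (dec x)))

      strengthen : ∀ p → mapA Fa k (σf p) ≡ h p
      strengthen (w , a) = sym (mapA-∘ Fa k (w ,_) (f (w , a)))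

    binddt-ret : ∀ Fa {A B} (f : W × A → ⟦ Fa ⟧ (T B)) (a : A) → binddt Fa f (ret a) ≡ f (retW a)
    binddt-ret Fa f a = begin
      mapA Fa join (dist Fa (mapT f (dec (ret a))))
        ≡⟨ cong (mapA Fa join ∘ dist Fa ∘ mapT f) (dec-ret a) ⟩
      mapA Fa join (dist Fa (mapT f (ret (retW a))))
        ≡⟨ cong (mapA Fa join ∘ dist Fa) (ret-nat f (retW a)) ⟩
      mapA Fa join (dist Fa (ret (f (retW a))))
        ≡⟨ cong (mapA Fa join) (dist-ret Fa (f (retW a))) ⟩
      mapA Fa join (mapA Fa ret (f (retW a)))
        ≡⟨ mapA-retract Fa join-ret (f (retW a)) ⟩
      f (retW a)
        ∎

    binddt-morph : ∀ {Fa Ga} (ψ : Morph Fa Ga) {A B} (f : W × A → ⟦ Fa ⟧ (T B)) (x : T A) →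
                   Morph.φ ψ (binddt Fa f x) ≡ binddt Ga (Morph.φ ψ ∘ f) x
    binddt-morph {Fa} {Ga} ψ f x = begin
      φ (mapA Fa join (dist Fa (mapT f (dec x))))
        ≡⟨ Morph.natural ψ join _ ⟩
      mapA Ga join (φ (dist Fa (mapT f (dec x))))
        ≡⟨ cong (mapA Ga join) (dist-morph ψ _) ⟩
      mapA Ga join (dist Ga (mapT φ (mapT f (dec x))))
        ≡⟨ cong (mapA Ga join ∘ dist Ga) (map-∘ φ f (dec x)) ⟨
      mapA Ga join (dist Ga (mapT (φ ∘ f) (dec x)))
        ∎
      where open Morph ψ using (φ)

    isKDTM : IsKDTM (toK D)
    isKDTM = record
      { K1 = λ x → trans (binddt-IdA-ret extr x) (dec-extr x)
      ; K2 = binddt-ret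
      ; K3 = binddt-binddt
      ; K4 = binddt-morph
      }

    toD∘toK≈id : toD (toK D) ≈D D
    toD∘toK≈id = record
      { mapT-eq = λ f x → trans (binddt-IdA-ret (f ∘ extr) x) (mapT-extr-dec f x)
      ; ret-eq  = λ _ → refl
      ; join-eq = λ x → cong join (trans (dist-id _) (dec-extr x))
      ; dec-eq  = λ x → trans (binddt-IdA-ret id x) (map-id (dec x))
      ; dist-eq = dist-eq
      }
      where
      dist-eq : ∀ Fa {A} (x : T (⟦ Fa ⟧ A)) → binddt Fa (mapA Fa ret ∘ extr) x ≡ dist Fa x
      dist-eq Fa x = begin
        mapA Fa join (dist Fa (mapT (mapA Fa ret ∘ extr) (dec x)))
          ≡⟨ cong (mapA Fa join ∘ dist Fa) (mapT-extr-dec (mapA Fa ret) x) ⟩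
        mapA Fa join (dist Fa (mapT (mapA Fa ret) x))
          ≡⟨ cong (mapA Fa join) (dist-nat Fa ret x) ⟨
        mapA Fa join (mapA Fa (mapT ret) (dist Fa x))
          ≡⟨ mapA-retract Fa join-map-ret (dist Fa x) ⟩
        dist Fa x
          ∎

theorem24 : (ext : Extensionality 0ℓ 0ℓ)
            (W : Set) (_·_ : W → W → W) (1W : W) → IsMonoid _≡_ _·_ 1W →
            (T : Set → Set) →
            let open Theory ext W _·_ 1W in
            ((D : DTMOps T) → IsDTM D → IsKDTM (toK D)) ×
            ((K : KOps T) → IsKDTM K → IsDTM (toD K)) ×
            ((D : DTMOps T) → IsDTM D → toD (toK D) ≈D D) ×
            ((K : KOps T) → IsKDTM K → toK (toD K) ≈K K)
theorem24 ext W _·_ 1W isMonoid T =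
    DTMToKleisli.isKDTM
  , KleisliToDTM.isDTM identityʳ
  , DTMToKleisli.toD∘toK≈id
  , KleisliToDTM.toK∘toD≈id identityʳ
  where
  open Equivalence ext W _·_ 1W
  open IsMonoid isMonoid using (identityʳ)
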